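{- Let $k\ge1$. The class $\mathcal K(3)$ of graphs containing a clique of size $3$ (i.e., the class of models of $\exists x\exists y\exists z(Exy\wedge Eyz\wedge Exz)$) cannot be decided by a $k$ adaptive right hom algorithm (and hence not by a right hom algorithm).
   Context: Graphs are finite, simple, undirected, with non-empty vertex set; classes are closed under isomorphism; $\textsc{Graph}$ is the class of all graphs. $\hom(G,F)$ is the number of homomorphisms from $G$ to $F$. A class $\mathcal C$ can be decided by a right hom algorithm if there are $k\ge1$ and graphs $F_1,\dots,F_k$ such that for all graphs $G,H$, $\hom(G,F_i)=\hom(H,F_i)$ for all $i\in[k]$ implies ($G\in\mathcal C\iff H\in\mathcal C$). For $k\ge1$, a $k$ adaptive right hom algorithm for $\mathcal C$ consists of a graph $F$, a function $N:\bigcup_{i\in[k-1]}\mathbb N^i\to\textsc{Graph}$, and a set $X\subseteq\mathbb N^k$ such that for all graphs $G$: $G\in\mathcal C\iff(n_1,\dots,n_k)\in X$, where $n_1:=\hom(G,F)$ and $n_{j+1}:=\hom(G,N(n_1,\dots,n_j))$ for $j\in[k-1]$. -}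

module Defs where

open import Data.Nat using (ℕ; zero; suc)
open import Data.Fin using (Fin; zero; suc)
open import Data.Bool using (Bool; true; false; not; _∨_; _∧_)
open import Data.List using (List; []; _∷_; map; concatMap; allFin; filterᵇ; length; foldr)
open import Data.Vec using (Vec; []; _∷_; _∷ʳ_)
open import Data.Product using (Σ; ∃; _×_; _,_)
open import Relation.Binary.PropositionalEquality using (_≡_)
open import Function.Bundles using (_⇔_)

record Graph : Set where
  field
    n      : ℕ
    adj    : Fin (suc n) → Fin (suc n) → Bool
    sym    : ∀ u v → adj u v ≡ adj v u
    irrefl : ∀ v → adj v v ≡ false

open Graph public

V : Graph → Set
V G = Fin (suc (n G))

allFuns : (a b : ℕ) → List (Fin a → Fin b)
allFuns zero    b = (λ ()) ∷ []
allFuns (suc a) b = concatMap (λ f → map (λ y → ext y f) (allFin b)) (allFuns a b)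
  where
  ext : Fin b → (Fin a → Fin b) → Fin (suc a) → Fin b
  ext y f zero    = y
  ext y f (suc i) = f i

allᵇ : {A : Set} → (A → Bool) → List A → Bool
allᵇ p = foldr (λ x b → p x ∧ b) true

isHom : (G F : Graph) → (V G → V F) → Bool
isHom G F f =
  allᵇ (λ u → allᵇ (λ v → not (adj G u v) ∨ adj F (f u) (f v)) (allFin (suc (n G))))
      (allFin (suc (n G)))

hom : Graph → Graph → ℕ
hom G F = length (filterᵇ (isHom G F) (allFuns (suc (n G)) (suc (n F))))

HasTriangle : Graph → Set
HasTriangle G = Σ (V G) λ x → Σ (V G) λ y → Σ (V G) λ z →
  (adj G x y ≡ true) × (adj G y z ≡ true) × (adj G x z ≡ true)

-- A class of graphs (closed under isomorphism when used; K(3) is).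
Class : Set₁
Class = Graph → Set

DecidedByRightHom : Class → Set
DecidedByRightHom C =
  Σ ℕ λ k → Σ (Fin (suc k) → Graph) λ Fs →
    ∀ (G H : Graph) → (∀ i → hom G (Fs i) ≡ hom H (Fs i)) → (C G ⇔ C H)

-- Data of an adaptive right hom algorithm: the first graph F and the
-- function N on tuples of length ≥ 1 (its values on tuples of length ≥ k are
-- never used), and the accepting set X ⊆ ℕ^k.
record AdaptiveRightHom (k : ℕ) : Set₁ where
  field
    F : Graph
    N : ∀ {j} → Vec ℕ (suc j) → Graph
    X : Vec ℕ k → Set

query : ∀ {k j} → AdaptiveRightHom k → Vec ℕ j → Graph
query A []       = AdaptiveRightHom.F A
query A (x ∷ xs) = AdaptiveRightHom.N A (x ∷ xs)

answers : ∀ {k} → AdaptiveRightHom k → Graph → (j : ℕ) → Vec ℕ j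
answers A G zero    = []
answers A G (suc j) = answers A G j ∷ʳ hom G (query A (answers A G j))

AdaptivelyDecides : ∀ {k} → AdaptiveRightHom k → Class → Set
AdaptivelyDecides {k} A C = ∀ G → C G ⇔ AdaptiveRightHom.X A (answers A G k)

-- Both graphs of the construction are shift graphs, possibly with a triangle
-- added: the vertices are the pairs (i, j), i < j < m, and (i, j) is adjacent to
-- (j, k).  A shift graph is triangle-free, yet it has no proper colouring with c
-- colours once m > 2 ^ c (Erdős–Hajnal).  As a homomorphism into a loopless
-- graph F is a proper colouring with |V F| colours, a large enough shift graph,
-- with or without the triangle, has no homomorphism at all into any of finitely
-- many given graphs.  An adaptive algorithm thus receives only zeros on both
-- graphs, asks the same questions, and cannot tell them apart.
module Submission where

open import Defs
open import Data.Nat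
  using (ℕ; zero; suc; _+_; _*_; _^_; _⊔_; _≤_; _<_; _<?_) renaming (_≟_ to _≟ℕ_)
open import Data.Nat.Properties
  using (<-irrefl; <-trans; ≤-trans; n<1+n; m<n⇒m<1+n; m≤m⊔n; m≤n⊔m; m≤n+m;
         ^-monoʳ-≤)
open import Data.Fin using (Fin; zero; suc; toℕ; fromℕ<; combine; remQuot; funToFin; finToFun)
open import Data.Fin.Properties
  using (_≟_; any?; <-cmp; remQuot-combine; finToFun-funToFin; injective⇒≤; toℕ-fromℕ<;
         2↔Bool)
open import Data.Bool using (Bool; true; false; not; _∨_; T)
open import Data.Bool.Properties using (T-∧; T-≡)
open import Data.Empty using (⊥; ⊥-elim)
open import Data.List using (length)
open import Data.List.Properties using (filter-none)
open import Data.List.Relation.Unary.All using (universal)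
open import Data.List.Membership.Propositional using (_∈_)
open import Data.List.Membership.Propositional.Properties using (∈-allFin)
open import Data.List.Relation.Unary.Any using (here; there)
open import Data.Vec using (Vec; []; _∷ʳ_)
open import Data.Product as Product using (∃; _×_; _,_; proj₁; proj₂)
open import Data.Sum as Sum using (_⊎_; inj₁; inj₂; [_,_])
open import Function using (_∘_)
open import Function.Bundles using (mk⇔; Equivalence; Injection; Inverse)
open import Function.Properties.Inverse using (↔-sym; ↔⇒↣)
open import Level using (0ℓ)
open import Relation.Binary.Core using (Rel)
open import Relation.Binary.Definitions using (Decidable; Symmetric; tri<; tri≈; tri>)
open import Relation.Binary.PropositionalEquality as ≡
  using (_≡_; _≢_; refl; cong; subst; subst₂)
open import Relation.Nullary using (¬_; Dec; yes; does; ¬?; _×-dec_; _⊎-dec_)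
open import Relation.Nullary.Decidable using (does-⇔; dec-true; dec-false)
open import Relation.Nullary.Decidable.Core using (T?)

does⇒ : ∀ {A : Set} (a? : Dec A) → T (does a?) → A
does⇒ (yes a) _ = a

IsHom : (G F : Graph) → (V G → V F) → Set
IsHom G F f = ∀ u v → T (adj G u v) → T (adj F (f u) (f v))

allᵇ-∈ : ∀ {A : Set} {p : A → Bool} {x xs} → T (allᵇ p xs) → x ∈ xs → T (p x)
allᵇ-∈ t (here refl)  = proj₁ (Equivalence.to T-∧ t)
allᵇ-∈ t (there x∈xs) = allᵇ-∈ (proj₂ (Equivalence.to T-∧ t)) x∈xs

isHom⇒IsHom : ∀ G F f → T (isHom G F f) → IsHom G F f
isHom⇒IsHom G F f t u v = modusPonens (allᵇ-∈ (allᵇ-∈ t (∈-allFin u)) (∈-allFin v))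
  where
  modusPonens : ∀ {a b} → T (not a ∨ b) → T a → T b
  modusPonens {true} t _ = t

hom≡0 : ∀ G F → (∀ f → ¬ IsHom G F f) → hom G F ≡ 0
hom≡0 G F noHom = cong length (filter-none (T? ∘ isHom G F)
  (universal (λ f → noHom f ∘ isHom⇒IsHom G F f) (allFuns (suc (n G)) (suc (n F)))))

IsHom⇒≢ : ∀ G F {f} → IsHom G F f → ∀ {u v} → T (adj G u v) → f u ≢ f v
IsHom⇒≢ G F {f} f-hom {u} {v} uv fu≡fv =
  subst T (≡.trans (cong (adj F (f u)) (≡.sym fu≡fv)) (irrefl F (f u))) (f-hom u v uv)

graphOf : (n : ℕ) {R : Rel (Fin (suc n)) 0ℓ} →
          Decidable R → Symmetric R → (∀ v → ¬ R v v) → Graph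
graphOf n R? R-sym R-irrefl = record
  { n      = n
  ; adj    = λ u v → does (R? u v)
  ; sym    = λ u v → does-⇔ (mk⇔ R-sym R-sym) (R? u v) (R? v u)
  ; irrefl = λ v → dec-false (R? v v) (R-irrefl v)
  }

Arc : Rel (ℕ × ℕ) 0ℓ
Arc (a , b) (b′ , c) = a < b × b ≡ b′ × b′ < c

arc? : Decidable Arc
arc? (a , b) (b′ , c) = a <? b ×-dec b ≟ℕ b′ ×-dec b′ <? c

Arc-irrefl : ∀ p → ¬ Arc p p
Arc-irrefl _ (a<b , b≡a , _) = <-irrefl (≡.sym b≡a) a<b

Arc⇒proj₁< : ∀ {p q} → Arc p q → proj₁ p < proj₁ q
Arc⇒proj₁< (a<b , refl , _) = a<b

Adjacent : Rel (ℕ × ℕ) 0ℓ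
Adjacent p q = Arc p q ⊎ Arc q p

no-cyclic-triangle : ∀ {x y z} → Arc x y → Arc y z → Arc z x → ⊥
no-cyclic-triangle xy yz zx =
  <-irrefl refl (<-trans (<-trans (Arc⇒proj₁< xy) (Arc⇒proj₁< yz)) (Arc⇒proj₁< zx))

no-transitive-triangle : ∀ {x y z} → Arc x y → Arc y z → Arc x z → ⊥
no-transitive-triangle (_ , refl , _) (b<c , refl , _) (_ , b≡c , _) = <-irrefl b≡c b<c

Adjacent-triangle-free : ∀ {x y z} → Adjacent x y → Adjacent y z → Adjacent x z → ⊥
Adjacent-triangle-free (inj₁ xy) (inj₁ yz) (inj₁ xz) = no-transitive-triangle xy yz xz
Adjacent-triangle-free (inj₁ xy) (inj₁ yz) (inj₂ zx) = no-cyclic-triangle xy yz zx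
Adjacent-triangle-free (inj₁ xy) (inj₂ zy) (inj₁ xz) = no-transitive-triangle xz zy xy
Adjacent-triangle-free (inj₁ xy) (inj₂ zy) (inj₂ zx) = no-transitive-triangle zx xy zy
Adjacent-triangle-free (inj₂ yx) (inj₁ yz) (inj₁ xz) = no-transitive-triangle yx xz yz
Adjacent-triangle-free (inj₂ yx) (inj₁ yz) (inj₂ zx) = no-transitive-triangle yz zx yx
Adjacent-triangle-free (inj₂ yx) (inj₂ zy) (inj₁ xz) = no-cyclic-triangle xz zy yx
Adjacent-triangle-free (inj₂ yx) (inj₂ zy) (inj₂ zx) = no-transitive-triangle zy yx zx

pairOf : ∀ m → Fin (m * m) → ℕ × ℕ
pairOf m = Product.map toℕ toℕ ∘ remQuot {m} m

pairOf-combine : ∀ {m} (i j : Fin m) → pairOf m (combine i j) ≡ (toℕ i , toℕ j)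
pairOf-combine {m} i j = cong (Product.map toℕ toℕ) (remQuot-combine {m} {m} i j)

ShiftEdge : ∀ m → Rel (Fin (m * m)) 0ℓ
ShiftEdge m u v = Adjacent (pairOf m u) (pairOf m v)

shiftEdge? : ∀ m → Decidable (ShiftEdge m)
shiftEdge? m u v = arc? (pairOf m u) (pairOf m v) ⊎-dec arc? (pairOf m v) (pairOf m u)

-- The shift graph on the ordered pairs of Fin (suc p); pairs (i , j) with
-- i ≥ j are isolated vertices.
shiftGraph : ℕ → Graph
shiftGraph p = graphOf (p + p * suc p) (shiftEdge? (suc p)) Sum.swap
  (λ v → [ Arc-irrefl (pairOf (suc p) v) , Arc-irrefl (pairOf (suc p) v) ])

shiftGraph-triangle-free : ∀ p → ¬ HasTriangle (shiftGraph p)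
shiftGraph-triangle-free p (x , y , z , xy , yz , xz) =
  Adjacent-triangle-free (edge x y xy) (edge y z yz) (edge x z xz)
  where
  edge : ∀ u v → adj (shiftGraph p) u v ≡ true → ShiftEdge (suc p) u v
  edge u v uv = does⇒ (shiftEdge? (suc p) u v) (Equivalence.from T-≡ uv)

module _ {m c : ℕ} (col : Fin m → Fin m → Fin c)
         (proper : ∀ {i j k} → toℕ i < toℕ j → toℕ j < toℕ k → col i j ≢ col j k)
  where

  private
    HasForwardColour : Fin m → Fin c → Set
    HasForwardColour i x = ∃ λ k → toℕ i < toℕ k × col i k ≡ x

    hasForwardColour? : ∀ i x → Dec (HasForwardColour i x)
    hasForwardColour? i x = any? λ k → toℕ i <? toℕ k ×-dec col i k ≟ x

    -- The set of colours on the edges leaving i forwards, as a number below 2 ^ c.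
    forwardColours : Fin m → Fin (2 ^ c)
    forwardColours i = funToFin (Inverse.from 2↔Bool ∘ does ∘ hasForwardColour? i)

    forwardColours-separates : ∀ {i j} → toℕ i < toℕ j → forwardColours i ≢ forwardColours j
    forwardColours-separates {i} {j} i<j eq = true≢false (begin
      true                         ≡⟨ ≡.sym (dec-true (hasForwardColour? i x) (j , i<j , refl)) ⟩
      does (hasForwardColour? i x) ≡⟨ agree ⟩
      does (hasForwardColour? j x) ≡⟨ dec-false (hasForwardColour? j x) noForward ⟩
      false                        ∎)
      where
      open ≡.≡-Reasoning
      x = col i j
      true≢false : true ≢ false
      true≢false ()
      noForward : ¬ HasForwardColour j x
      noForward (k , j<k , colⱼₖ≡colᵢⱼ) = proper i<j j<k (≡.sym colⱼₖ≡colᵢⱼ)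
      agree : does (hasForwardColour? i x) ≡ does (hasForwardColour? j x)
      agree = Injection.injective (↔⇒↣ (↔-sym 2↔Bool))
        (≡.trans (≡.sym (finToFun-funToFin _ x))
          (≡.trans (cong (λ w → finToFun w x) eq) (finToFun-funToFin _ x)))

  pairColouring-bound : m ≤ 2 ^ c
  pairColouring-bound = injective⇒≤ {f = forwardColours} injective
    where
    injective : ∀ {i j} → forwardColours i ≡ forwardColours j → i ≡ j
    injective {i} {j} eq with <-cmp i j
    ... | tri< i<j _ _ = ⊥-elim (forwardColours-separates i<j eq)
    ... | tri≈ _ i≡j _ = i≡j
    ... | tri> _ _ j<i = ⊥-elim (forwardColours-separates j<i (≡.sym eq))

shiftGraph-hom⇒bound : ∀ p F {f} → IsHom (shiftGraph p) F f → suc p ≤ 2 ^ suc (n F)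
shiftGraph-hom⇒bound p F {f} f-hom = pairColouring-bound (λ i j → f (combine i j))
  (λ i<j j<k → IsHom⇒≢ (shiftGraph p) F f-hom (edge i<j j<k))
  where
  edge : ∀ {i j k : Fin (suc p)} → toℕ i < toℕ j → toℕ j < toℕ k →
         T (adj (shiftGraph p) (combine i j) (combine j k))
  edge {i} {j} {k} i<j j<k = Equivalence.from T-≡
    (dec-true (shiftEdge? (suc p) (combine i j) (combine j k)) (inj₁ (subst₂ Arc
      (≡.sym (pairOf-combine i j)) (≡.sym (pairOf-combine j k)) (i<j , refl , j<k))))

InTriangle : ∀ {k} → Rel (Fin k) 0ℓ
InTriangle u v = toℕ u < 3 × toℕ v < 3 × u ≢ v

inTriangle? : ∀ {k} → Decidable (InTriangle {k})
inTriangle? u v = toℕ u <? 3 ×-dec toℕ v <? 3 ×-dec ¬? (u ≟ v)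

withTriangle : Graph → Graph
withTriangle G = graphOf (n G) {λ u v → InTriangle u v ⊎ T (adj G u v)}
  (λ u v → inTriangle? u v ⊎-dec T? (adj G u v))
  (λ {u} {v} → Sum.map (λ (u<3 , v<3 , u≢v) → v<3 , u<3 , u≢v ∘ ≡.sym)
                       (subst T (sym G u v)))
  (λ v → [ (λ (_ , _ , v≢v) → v≢v refl) , subst T (irrefl G v) ])

IsHom-withTriangle⁻ : ∀ G F {f} → IsHom (withTriangle G) F f → IsHom G F f
IsHom-withTriangle⁻ G F f-hom u v uv = f-hom u v
  (Equivalence.from T-≡ (dec-true (inTriangle? u v ⊎-dec T? (adj G u v)) (inj₂ uv)))

largeShift : ℕ → Graph
largeShift c = shiftGraph (2 + 2 ^ c)

withTriangle-largeShift-hasTriangle : ∀ c → HasTriangle (withTriangle (largeShift c))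
withTriangle-largeShift-hasTriangle c = zero , suc zero , suc (suc zero) , refl , refl , refl

largeShift-no-hom : ∀ c F {f} → suc (n F) ≤ c → ¬ IsHom (largeShift c) F f
largeShift-no-hom c F |F|≤c f-hom = <-irrefl refl (≤-trans (m≤n+m _ 2)
  (≤-trans (shiftGraph-hom⇒bound (2 + 2 ^ c) F f-hom) (^-monoʳ-≤ 2 |F|≤c)))

hom-largeShift≡0 : ∀ c F → suc (n F) ≤ c → hom (largeShift c) F ≡ 0
hom-largeShift≡0 c F |F|≤c = hom≡0 (largeShift c) F λ f → largeShift-no-hom c F |F|≤c

hom-withTriangle-largeShift≡0 : ∀ c F → suc (n F) ≤ c → hom (withTriangle (largeShift c)) F ≡ 0
hom-withTriangle-largeShift≡0 c F |F|≤c = hom≡0 (withTriangle (largeShift c)) F λ f →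
  largeShift-no-hom c F |F|≤c ∘ IsHom-withTriangle⁻ (largeShift c) F

finite-bound : ∀ {k} (g : Fin k → ℕ) → ∃ λ B → ∀ i → g i ≤ B
finite-bound {zero}  g = 0 , λ ()
finite-bound {suc k} g with finite-bound (g ∘ suc)
... | B , g≤B = g zero ⊔ B , λ where
  zero    → m≤m⊔n (g zero) B
  (suc i) → ≤-trans (g≤B i) (m≤n⊔m (g zero) B)

zeros : ∀ j → Vec ℕ j
zeros zero    = []
zeros (suc j) = zeros j ∷ʳ 0

answers-zeros : ∀ {k} (A : AdaptiveRightHom k) G j →
                (∀ i → i < j → hom G (query A (zeros i)) ≡ 0) → answers A G j ≡ zeros j
answers-zeros A G zero    _      = refl
answers-zeros A G (suc j) hom≡0ᵢ
  rewrite answers-zeros A G j (λ i i<j → hom≡0ᵢ i (m<n⇒m<1+n i<j)) =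
  cong (zeros j ∷ʳ_) (hom≡0ᵢ j (n<1+n j))

adaptive-answers-agree : ∀ {k} (A : AdaptiveRightHom k) →
  ∃ λ c → answers A (withTriangle (largeShift c)) k ≡ answers A (largeShift c) k
adaptive-answers-agree {k} A = c , ≡.trans
  (answers≡zeros (withTriangle (largeShift c)) (hom-withTriangle-largeShift≡0 c))
  (≡.sym (answers≡zeros (largeShift c) (hom-largeShift≡0 c)))
  where
  bound = finite-bound {k} λ i → suc (n (query A (zeros (toℕ i))))
  c = proj₁ bound
  answers≡zeros : ∀ G → (∀ F → suc (n F) ≤ c → hom G F ≡ 0) → answers A G k ≡ zeros k
  answers≡zeros G hom≡0 = answers-zeros A G k λ i i<k → hom≡0 (query A (zeros i))
    (subst (λ t → suc (n (query A (zeros t))) ≤ c) (toℕ-fromℕ< i<k)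
           (proj₂ bound (fromℕ< i<k)))

homs-agree : ∀ {k} (Fs : Fin k → Graph) →
  ∃ λ c → ∀ i → hom (withTriangle (largeShift c)) (Fs i) ≡ hom (largeShift c) (Fs i)
homs-agree Fs =
  let c , |Fs|≤c = finite-bound (λ i → suc (n (Fs i)))
  in  c , λ i → ≡.trans (hom-withTriangle-largeShift≡0 c (Fs i) (|Fs|≤c i))
                        (≡.sym (hom-largeShift≡0 c (Fs i) (|Fs|≤c i)))

proposition9p3 : ∀ (k : ℕ) → 1 ≤ k →
    (∀ (A : AdaptiveRightHom k) → ¬ AdaptivelyDecides A HasTriangle)
    × ¬ DecidedByRightHom HasTriangle
proposition9p3 k _ = adaptive , nonAdaptive
  where
  noTransfer : ∀ c → ¬ (HasTriangle (withTriangle (largeShift c)) → HasTriangle (largeShift c))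
  noTransfer c transfer =
    shiftGraph-triangle-free (2 + 2 ^ c) (transfer (withTriangle-largeShift-hasTriangle c))

  adaptive : ∀ A → ¬ AdaptivelyDecides A HasTriangle
  adaptive A decides =
    let c , same = adaptive-answers-agree A
    in  noTransfer c (Equivalence.from (decides (largeShift c))
                      ∘ subst (AdaptiveRightHom.X A) same
                      ∘ Equivalence.to (decides (withTriangle (largeShift c))))

  nonAdaptive : ¬ DecidedByRightHom HasTriangle
  nonAdaptive (_ , Fs , decides) =
    let c , same = homs-agree Fs
    in  noTransfer c (Equivalence.to (decides (withTriangle (largeShift c)) (largeShift c) same))
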